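{- For all integers $r,s\geq 2$, the complete bipartite graph $K_{2r,2s}$ is doubly Eulerian.
   Context: An Eulerian circuit is a closed trail traversing every edge exactly once. Let $G$ be Eulerian with $m$ edges and $u$ a vertex. Two Eulerian circuits $u,v_1,\ldots,v_{m-1},u$ and $u,w_1,\ldots,w_{m-1},u$ are avoiding if for every $1\le i\le m-1$, $v_i\neq w_i$ and $v_i$ is not adjacent to $w_i$. $G$ is doubly Eulerian if it is Eulerian and for every vertex $u$ there is a pair of avoiding Eulerian circuits starting and ending at $u$. -}

module Defs where

open import Level using (0ℓ)
open import Data.Nat using (ℕ; zero; suc; _<_)
open import Data.Fin using (Fin; zero; suc; toℕ; inject₁; fromℕ)
open import Data.Sum using (_⊎_; inj₁; inj₂)
open import Data.Product using (_×_; Σ; ∃; ∃-syntax)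
open import Data.Unit using (⊤)
open import Data.Empty using (⊥)
open import Relation.Nullary using (¬_)
open import Relation.Binary.PropositionalEquality using (_≡_; _≢_)

record Graph : Set₁ where
  field
    V      : Set
    Adj    : V → V → Set
    sym    : ∀ {x y} → Adj x y → Adj y x
    irrefl : ∀ {x} → ¬ Adj x x
open Graph public

record ClosedWalk (G : Graph) (u : V G) (m : ℕ) : Set where
  field
    vtx   : Fin (suc m) → V G
    start : vtx zero ≡ u
    end   : vtx (fromℕ m) ≡ u
    steps : ∀ (i : Fin m) → Adj G (vtx (inject₁ i)) (vtx (suc i))
open ClosedWalk public

Traverses : {G : Graph} {u : V G} {m : ℕ} → ClosedWalk G u m → Fin m → V G → V G → Set
Traverses W i a b =
  (vtx W (inject₁ i) ≡ a × vtx W (suc i) ≡ b) ⊎ (vtx W (inject₁ i) ≡ b × vtx W (suc i) ≡ a)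

record EulerianCircuit (G : Graph) (u : V G) (m : ℕ) : Set where
  field
    walk       : ClosedWalk G u m
    covers     : ∀ a b → Adj G a b → ∃[ i ] Traverses walk i a b
    onlyOnce   : ∀ a b → Adj G a b → ∀ i j →
                 Traverses walk i a b → Traverses walk j a b → i ≡ j
open EulerianCircuit public

Eulerian : Graph → Set
Eulerian G = Σ (V G) λ u → ∃[ m ] EulerianCircuit G u m

Avoiding : {G : Graph} {u : V G} {m : ℕ} → EulerianCircuit G u m → EulerianCircuit G u m → Set
Avoiding {G} {u} {m} C D =
  ∀ (i : Fin (suc m)) → 0 < toℕ i → toℕ i < m →
    (vtx (walk C) i ≢ vtx (walk D) i) × ¬ Adj G (vtx (walk C) i) (vtx (walk D) i)

DoublyEulerian : Graph → Set
DoublyEulerian G =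
  Eulerian G ×
  (∀ (u : V G) → ∃[ m ] Σ (EulerianCircuit G u m) λ C →
                         Σ (EulerianCircuit G u m) λ D → Avoiding C D)

KAdj : {a b : ℕ} → (Fin a ⊎ Fin b) → (Fin a ⊎ Fin b) → Set
KAdj (inj₁ _) (inj₁ _) = ⊥
KAdj (inj₁ _) (inj₂ _) = ⊤
KAdj (inj₂ _) (inj₁ _) = ⊤
KAdj (inj₂ _) (inj₂ _) = ⊥

KAdj-sym : {a b : ℕ} {x y : Fin a ⊎ Fin b} → KAdj x y → KAdj y x
KAdj-sym {x = inj₁ _} {inj₂ _} p = p
KAdj-sym {x = inj₂ _} {inj₁ _} p = p

KAdj-irrefl : {a b : ℕ} {x : Fin a ⊎ Fin b} → ¬ KAdj x x
KAdj-irrefl {x = inj₁ _} ()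
KAdj-irrefl {x = inj₂ _} ()

K : ℕ → ℕ → Graph
K a b = record
  { V = Fin a ⊎ Fin b
  ; Adj = KAdj
  ; sym = KAdj-sym
  ; irrefl = λ {x} → KAdj-irrefl {x = x}
  }

module Submission where

-- Write the sides of K_{2R,2S} as A = Fin 2R and B = Fin 2 × Fin S. A closed walk from an
-- A-vertex alternates α 0, β 0, α 1, β 1, …, α T, and its step 2t (resp. 2t+1) uses the edge
-- α t β t (resp. α (t+1) β t); an Eulerian circuit has T = 2RS.
--
-- The first circuit C runs cyclically around A, α t = t mod 2R, and visits β t = (t mod 2, ⌊t/2R⌋):
-- in round g the B-vertex (e, g) meets the perfect matching {i, i+1}, i ≡ e (mod 2), so every
-- edge is used once. The second circuit D is C advanced by one A-step, α′ t = α (t+1) and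
-- β′ t = β (t+1), repaired at both ends so that it starts and stops at 0, namely
-- 0, (1,0), 2, (0,0), 3, …, A−1, (1,0), 1, (0,0), 0, with the B-vertices (1,0) and (1,S−1)
-- exchanged at time A−2; the seven edges of D touched by the repair are exactly the seven edges
-- of C that the shift misses. At every interior time the two circuits then sit at different
-- A-vertices (t ≢ t+1 mod 2R, and 1 ≢ 2R−1 at the end) or at B-vertices with different parity
-- labels, and vertices on the same side are never adjacent. Automorphisms of K_{2R,2S}
-- (permuting a side, swapping the sides) move the pair to any starting vertex.

open import Defs hiding (sym)
open import Data.Empty using (⊥-elim)
open import Data.Fin using (Fin; zero; suc; toℕ; fromℕ; fromℕ<; inject₁; combine; punchOut)
open import Data.Fin.Permutation as Perm
  using (Permutation′; _⟨$⟩ʳ_; _⟨$⟩ˡ_; inverseˡ; inverseʳ; transpose)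
open import Data.Fin.Properties
  using (toℕ-injective; toℕ<n; toℕ-fromℕ; toℕ-fromℕ<; toℕ-inject₁;
         combine-surjective; combine-injectiveˡ; any?; punchOut-injective; injective⇒≤)
  renaming (_≟_ to _≟ᶠ_)
open import Data.Nat
  using (ℕ; zero; suc; pred; _+_; _*_; _∸_; _/_; _%_; ⌊_/2⌋; ⌈_/2⌉; NonZero;
         _<_; _≤_; z≤n; s≤s; _<?_; _≟_)
open import Data.Nat.DivMod
  using (_mod_; m%n<n; [m+kn]%n≡m%n; m<n⇒m%n≡m; %-distribˡ-+; n%n≡0; m*n%n≡0;
         +-distrib-/; m<n⇒m/n≡0; m*n/n≡m)
open import Data.Nat.Properties
  using (+-suc; +-identityʳ; n≡⌊n+n/2⌋; n≡⌈n+n/2⌉; +-mono-≤; +-mono-<; +-monoˡ-<; *-monoˡ-≤;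
         ≤-trans; <-trans; ≤-antisym; ≤-pred; n<1+n; m≤n+m; m<m+n;
         1+n≰n; 1+n≢n; ≰⇒>; <⇒≱; ≮⇒≥; <⇒≢; >⇒≢)
open import Data.Nat.Solver using (module +-*-Solver)
open import Data.Product using (Σ; _×_; _,_; ∃; ∃-syntax; proj₁; proj₂; uncurry)
open import Data.Sum as Sum using (_⊎_; inj₁; inj₂)
open import Data.Sum.Properties using (inj₁-injective; inj₂-injective; swap-involutive)
open import Data.Unit using (tt)
open import Function using (_∘_; _$_)
open import Function.Definitions using (Injective)
open import Relation.Nullary using (¬_; yes; no)
open import Relation.Binary.PropositionalEquality
open +-*-Solver using (solve; _:=_; con; _:+_; _:*_)

Surjective : ∀ {m n} → (Fin m → Fin n) → Set
Surjective f = ∀ y → ∃ λ i → f i ≡ y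

injective⇒surjective : ∀ {n} {f : Fin n → Fin n} → Injective _≡_ _≡_ f → Surjective f
injective⇒surjective {zero}  _ ()
injective⇒surjective {suc n} {f} f-injective y with any? (λ i → f i ≟ᶠ y)
... | yes hit  = hit
... | no  miss = ⊥-elim (1+n≰n (injective⇒≤ punchOut∘f-injective))
  where
  y≢f : ∀ i → y ≢ f i
  y≢f i y≡fi = miss (i , sym y≡fi)
  punchOut∘f-injective : Injective _≡_ _≡_ (λ i → punchOut (y≢f i))
  punchOut∘f-injective {i} {j} eq = f-injective (punchOut-injective (y≢f i) (y≢f j) eq)

surjective⇒injective : ∀ {m n} → m ≡ n → {f : Fin m → Fin n} → Surjective f → Injective _≡_ _≡_ f
surjective⇒injective refl {f} f-surjective = cancel (g-surjective _) (g-surjective _)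
  where
  g : _ → _
  g y = proj₁ (f-surjective y)
  f∘g : ∀ y → f (g y) ≡ y
  f∘g y = proj₂ (f-surjective y)
  g-surjective : Surjective g
  g-surjective = injective⇒surjective λ {y} {z} eq → trans (sym (f∘g y)) (trans (cong f eq) (f∘g z))
  cancel : ∀ {i j} → ∃ (λ y → g y ≡ i) → ∃ (λ z → g z ≡ j) → f i ≡ f j → i ≡ j
  cancel (y , refl) (z , refl) eq = cong g (trans (sym (f∘g y)) (trans eq (f∘g z)))

Fin2-≢≢⇒≡ : ∀ {c d e : Fin 2} → c ≢ d → e ≢ c → e ≡ d
Fin2-≢≢⇒≡ {zero}     {zero}     c≢d _ = ⊥-elim (c≢d refl)
Fin2-≢≢⇒≡ {suc zero} {suc zero} c≢d _ = ⊥-elim (c≢d refl)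
Fin2-≢≢⇒≡ {zero}     {suc zero} {zero}     _ e≢c = ⊥-elim (e≢c refl)
Fin2-≢≢⇒≡ {zero}     {suc zero} {suc zero} _ _   = refl
Fin2-≢≢⇒≡ {suc zero} {zero}     {zero}     _ _   = refl
Fin2-≢≢⇒≡ {suc zero} {zero}     {suc zero} _ e≢c = ⊥-elim (e≢c refl)

module _ {d : ℕ} .{{_ : NonZero d}} where

  toℕ-mod : ∀ t → toℕ (t mod d) ≡ t % d
  toℕ-mod t = toℕ-fromℕ< (m%n<n t d)

  mod-periodic : ∀ i j → (i + j * d) mod d ≡ i mod d
  mod-periodic i j = toℕ-injective (trans (toℕ-mod _) (trans ([m+kn]%n≡m%n i j d) (sym (toℕ-mod i))))

  toℕ-mod-id : (x : Fin d) → toℕ x mod d ≡ x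
  toℕ-mod-id x = toℕ-injective (trans (toℕ-mod _) (m<n⇒m%n≡m (toℕ<n x)))

  suc-%≡[1+%]% : 1 < d → ∀ t → suc t % d ≡ suc (t % d) % d
  suc-%≡[1+%]% 1<d t = trans (%-distribˡ-+ 1 t d) (cong (λ k → (k + t % d) % d) (m<n⇒m%n≡m 1<d))

  suc-%≢% : 1 < d → ∀ t → suc t % d ≢ t % d
  suc-%≢% 1<d t eq with suc (t % d) <? d
  ... | yes 1+r<d = 1+n≢n (trans (sym (m<n⇒m%n≡m 1+r<d)) (trans (sym (suc-%≡[1+%]% 1<d t)) eq))
  ... | no  1+r≮d = 1+n≰n (subst (1 <_) (trans (sym 1+r≡d) (cong suc r≡0)) 1<d)
    where
    1+r≡d : suc (t % d) ≡ d
    1+r≡d = ≤-antisym (m%n<n t d) (≮⇒≥ 1+r≮d)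
    r≡0 : t % d ≡ 0
    r≡0 = trans (sym eq) (trans (suc-%≡[1+%]% 1<d t) (trans (cong (_% d) 1+r≡d) (n%n≡0 d)))

  suc-mod≢mod : 1 < d → ∀ t → suc t mod d ≢ t mod d
  suc-mod≢mod 1<d t eq = suc-%≢% 1<d t (trans (sym (toℕ-mod (suc t))) (trans (cong toℕ eq) (toℕ-mod t)))

infixl 5 _[_≔_]

_[_≔_] : ∀ {X : Set} → (ℕ → X) → ℕ → X → ℕ → X
(f [ n ≔ v ]) t with t ≟ n
... | yes _ = v
... | no  _ = f t

[≔]-updated : ∀ {X : Set} {f : ℕ → X} n v → (f [ n ≔ v ]) n ≡ v
[≔]-updated n v with n ≟ n
... | yes _   = refl
... | no n≢n = ⊥-elim (n≢n refl)

[≔]-unchanged : ∀ {X : Set} {f : ℕ → X} n v {t} → t ≢ n → (f [ n ≔ v ]) t ≡ f t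
[≔]-unchanged n v {t} t≢n with t ≟ n
... | yes t≡n = ⊥-elim (t≢n t≡n)
... | no  _   = refl

module _ {a b : ℕ} where

  alternating : (ℕ → Fin a) → (ℕ → Fin b) → ℕ → Fin a ⊎ Fin b
  alternating α β zero          = inj₁ (α 0)
  alternating α β (suc zero)    = inj₂ (β 0)
  alternating α β (suc (suc p)) = alternating (α ∘ suc) (β ∘ suc) p

  edgeAt : (ℕ → Fin a) → (ℕ → Fin b) → ℕ → Fin a × Fin b
  edgeAt α β p = α ⌈ p /2⌉ , β ⌊ p /2⌋

  Joins : (Fin a ⊎ Fin b) → (Fin a ⊎ Fin b) → Fin a × Fin b → Set
  Joins v w (x , y) = (v ≡ inj₁ x × w ≡ inj₂ y) ⊎ (v ≡ inj₂ y × w ≡ inj₁ x)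

  Joins-KAdj : ∀ {v w e} → Joins v w e → KAdj v w
  Joins-KAdj (inj₁ (refl , refl)) = tt
  Joins-KAdj (inj₂ (refl , refl)) = tt

  Joins-unique : ∀ {v w x y x′ y′} → Joins v w (x , y) → Joins v w (x′ , y′) → (x , y) ≡ (x′ , y′)
  Joins-unique (inj₁ (refl , refl)) (inj₁ (refl , refl)) = refl
  Joins-unique (inj₂ (refl , refl)) (inj₂ (refl , refl)) = refl

  alternating-step : ∀ α β p → Joins (alternating α β p) (alternating α β (suc p)) (edgeAt α β p)
  alternating-step α β zero          = inj₁ (refl , refl)
  alternating-step α β (suc zero)    = inj₂ (refl , refl)
  alternating-step α β (suc (suc p)) = alternating-step (α ∘ suc) (β ∘ suc) p

  alternating-double : ∀ α β n → alternating α β (n + n) ≡ inj₁ (α n)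
  alternating-double α β zero = refl
  alternating-double α β (suc n) rewrite +-suc n n = alternating-double (α ∘ suc) (β ∘ suc) n

  alternating-suc-double : ∀ α β n → alternating α β (suc (n + n)) ≡ inj₂ (β n)
  alternating-suc-double α β zero = refl
  alternating-suc-double α β (suc n) rewrite +-suc n n = alternating-suc-double (α ∘ suc) (β ∘ suc) n

  double-or-suc-double : ∀ p → ∃ λ t → p ≡ t + t ⊎ p ≡ suc (t + t)
  double-or-suc-double zero       = 0 , inj₁ refl
  double-or-suc-double (suc zero) = 0 , inj₂ refl
  double-or-suc-double (suc (suc p)) with double-or-suc-double p
  ... | t , inj₁ refl = suc t , inj₁ (cong suc (sym (+-suc t t)))
  ... | t , inj₂ refl = suc t , inj₂ (cong (λ k → suc (suc k)) (sym (+-suc t t)))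

  alternating-apart : ∀ {α α′ : ℕ → Fin a} {β β′ : ℕ → Fin b} n →
                      (∀ t → 0 < t → t < n → α t ≢ α′ t) → (∀ t → β t ≢ β′ t) →
                      ∀ p → 0 < p → p < n + n →
                      let v = alternating α β p ; w = alternating α′ β′ p in v ≢ w × ¬ KAdj v w
  alternating-apart {α} {α′} {β} {β′} n α-apart β-apart p 0<p p<2n with double-or-suc-double p
  ... | t , inj₁ refl rewrite alternating-double α β t | alternating-double α′ β′ t =
    (λ eq → α-apart t (positive t 0<p) (half-< p<2n) (inj₁-injective eq)) , λ ()
    where
    positive : ∀ t → 0 < t + t → 0 < t
    positive (suc t) _ = s≤s z≤n
    half-< : ∀ {t} → t + t < n + n → t < n
    half-< lt = ≰⇒> λ n≤t → <⇒≱ lt (+-mono-≤ n≤t n≤t)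
  ... | t , inj₂ refl rewrite alternating-suc-double α β t | alternating-suc-double α′ β′ t =
    (λ eq → β-apart t (inj₂-injective eq)) , λ ()

  record Traversed (α : ℕ → Fin a) (β : ℕ → Fin b) (n : ℕ) (e : Fin a × Fin b) : Set where
    constructor traversedAt
    field
      step        : ℕ
      step<       : step < n + n
      edgeAt-step : edgeAt α β step ≡ e

  VisitEdge : (ℕ → Fin a) → (ℕ → Fin b) → ℕ → Fin a × Fin b → Set
  VisitEdge α β u e = (α u , β u) ≡ e ⊎ (α (suc u) , β u) ≡ e

  module _ {α : ℕ → Fin a} {β : ℕ → Fin b} {n : ℕ} where

    traversed-even : ∀ t → t < n → Traversed α β n (α t , β t)
    traversed-even t t<n = traversedAt (t + t) (+-mono-< t<n t<n) $
      cong₂ _,_ (cong α (sym (n≡⌈n+n/2⌉ t))) (cong β (sym (n≡⌊n+n/2⌋ t)))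

    traversed-odd : ∀ t → t < n → Traversed α β n (α (suc t) , β t)
    traversed-odd t t<n = traversedAt (suc (t + t)) (subst (_≤ n + n) (cong suc (+-suc t t)) (+-mono-≤ t<n t<n)) $
      cong₂ _,_ (cong (α ∘ suc) (sym (n≡⌊n+n/2⌋ t))) (cong β (sym (n≡⌈n+n/2⌉ t)))

    traversed-visitEdge : ∀ {e} u → u < n → VisitEdge α β u e → Traversed α β n e
    traversed-visitEdge u u<n (inj₁ refl) = traversed-even u u<n
    traversed-visitEdge u u<n (inj₂ refl) = traversed-odd u u<n

  module AlternatingCircuit (α : ℕ → Fin a) (β : ℕ → Fin b) (n : ℕ) {x : Fin a}
                            (α0 : α 0 ≡ x) (αn : α n ≡ x) where

    traverses : ∀ (i : Fin (n + n)) →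
                Joins (alternating α β (toℕ (inject₁ i))) (alternating α β (suc (toℕ i)))
                      (edgeAt α β (toℕ i))
    traverses i rewrite toℕ-inject₁ i = alternating-step α β (toℕ i)

    closedWalk : ClosedWalk (K a b) (inj₁ x) (n + n)
    closedWalk = record
      { vtx   = alternating α β ∘ toℕ
      ; start = cong inj₁ α0
      ; end   = begin
          alternating α β (toℕ (fromℕ (n + n))) ≡⟨ cong (alternating α β) (toℕ-fromℕ (n + n)) ⟩
          alternating α β (n + n)               ≡⟨ alternating-double α β n ⟩
          inj₁ (α n)                            ≡⟨ cong inj₁ αn ⟩
          inj₁ x                                ∎
      ; steps = λ i → Joins-KAdj (traverses i)
      }
      where open ≡-Reasoning

    traverses-edgeAt : ∀ i {x y} → edgeAt α β (toℕ i) ≡ (x , y) →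
                       Traverses closedWalk i (inj₁ x) (inj₂ y)
    traverses-edgeAt i refl = traverses i

    edgeAt-traversed : ∀ i {x y} → Traverses closedWalk i (inj₁ x) (inj₂ y) →
                       edgeAt α β (toℕ i) ≡ (x , y)
    edgeAt-traversed i = Joins-unique (traverses i)

    -- A walk with as many steps as there are edges that traverses every edge traverses each once.
    eulerianCircuit : n + n ≡ a * b → (∀ x y → Traversed α β n (x , y)) →
                      EulerianCircuit (K a b) (inj₁ x) (n + n)
    eulerianCircuit n+n≡ab traversed = record
      { walk     = closedWalk
      ; covers   = every-edge
      ; onlyOnce = each-once
      }
      where
      stepOf : ∀ x y → Fin (n + n)
      stepOf x y = fromℕ< (Traversed.step< (traversed x y))

      edgeAt-stepOf : ∀ x y → edgeAt α β (toℕ (stepOf x y)) ≡ (x , y)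
      edgeAt-stepOf x y = trans (cong (edgeAt α β) (toℕ-fromℕ< _)) (Traversed.edgeAt-step (traversed x y))

      every-edge : ∀ v w → KAdj v w → ∃[ i ] Traverses closedWalk i v w
      every-edge (inj₁ x) (inj₂ y) _ = stepOf x y , traverses-edgeAt _ (edgeAt-stepOf x y)
      every-edge (inj₂ y) (inj₁ x) _ = stepOf x y , Sum.swap (traverses-edgeAt _ (edgeAt-stepOf x y))

      code : Fin (n + n) → Fin (a * b)
      code = uncurry combine ∘ edgeAt α β ∘ toℕ

      code-surjective : Surjective code
      code-surjective c with combine-surjective {a} {b} c
      ... | x , y , refl = stepOf x y , cong (uncurry combine) (edgeAt-stepOf x y)

      same-edge : ∀ i j {x y} → Traverses closedWalk i (inj₁ x) (inj₂ y) →
                  Traverses closedWalk j (inj₁ x) (inj₂ y) → i ≡ j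
      same-edge i j ti tj = surjective⇒injective n+n≡ab code-surjective
        (cong (uncurry combine) (trans (edgeAt-traversed i ti) (sym (edgeAt-traversed j tj))))

      each-once : ∀ v w → KAdj v w → ∀ i j →
                  Traverses closedWalk i v w → Traverses closedWalk j v w → i ≡ j
      each-once (inj₁ x) (inj₂ y) _ i j ti tj = same-edge i j ti tj
      each-once (inj₂ y) (inj₁ x) _ i j ti tj = same-edge i j (Sum.swap ti) (Sum.swap tj)

record _≅_ (G H : Graph) : Set where
  field
    to       : V G → V H
    from     : V H → V G
    from∘to  : ∀ v → from (to v) ≡ v
    to∘from  : ∀ w → to (from w) ≡ w
    to-adj   : ∀ {v w} → Adj G v w → Adj H (to v) (to w)
    from-adj : ∀ {v w} → Adj H v w → Adj G (from v) (from w)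

AvoidingPairAt : (G : Graph) → V G → Set
AvoidingPairAt G u = ∃[ m ] Σ (EulerianCircuit G u m) λ C → Σ (EulerianCircuit G u m) λ D → Avoiding C D

module _ {G H : Graph} (φ : G ≅ H) where
  open _≅_ φ

  private
    to-injective : ∀ {v w} → to v ≡ to w → v ≡ w
    to-injective {v} {w} eq = trans (sym (from∘to v)) (trans (cong from eq) (from∘to w))

    from-transpose : ∀ {v w} → to v ≡ w → v ≡ from w
    from-transpose eq = trans (sym (from∘to _)) (cong from eq)

  mapWalk : ∀ {u m} → ClosedWalk G u m → ClosedWalk H (to u) m
  mapWalk W = record
    { vtx   = to ∘ vtx W
    ; start = cong to (start W)
    ; end   = cong to (end W)
    ; steps = to-adj ∘ steps W
    }

  mapWalk-traverses : ∀ {u m} (W : ClosedWalk G u m) {i v w} →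
                      Traverses W i v w → Traverses (mapWalk W) i (to v) (to w)
  mapWalk-traverses W (inj₁ (p , q)) = inj₁ (cong to p , cong to q)
  mapWalk-traverses W (inj₂ (p , q)) = inj₂ (cong to p , cong to q)

  mapWalk-traverses⁻ : ∀ {u m} (W : ClosedWalk G u m) {i v w} →
                       Traverses (mapWalk W) i v w → Traverses W i (from v) (from w)
  mapWalk-traverses⁻ W (inj₁ (p , q)) = inj₁ (from-transpose p , from-transpose q)
  mapWalk-traverses⁻ W (inj₂ (p , q)) = inj₂ (from-transpose p , from-transpose q)

  mapCircuit : ∀ {u m} → EulerianCircuit G u m → EulerianCircuit H (to u) m
  mapCircuit C = record
    { walk     = mapWalk (walk C)
    ; covers   = λ v w vw → let (i , t) = covers C (from v) (from w) (from-adj vw) in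
        i , subst₂ (Traverses (mapWalk (walk C)) i) (to∘from v) (to∘from w) (mapWalk-traverses (walk C) t)
    ; onlyOnce = λ v w vw i j ti tj →
        onlyOnce C (from v) (from w) (from-adj vw) i j
                 (mapWalk-traverses⁻ (walk C) ti) (mapWalk-traverses⁻ (walk C) tj)
    }

  mapAvoidingPair : ∀ {u} → AvoidingPairAt G u → AvoidingPairAt H (to u)
  mapAvoidingPair (m , C , D , C-D) = m , mapCircuit C , mapCircuit D , λ i 0<i i<m →
    let (apart , non-adjacent) = C-D i 0<i i<m in
    apart ∘ to-injective , λ adj → non-adjacent (subst₂ (Adj G) (from∘to _) (from∘to _) (from-adj adj))

KAdj-swap : ∀ {a b} {v w : Fin a ⊎ Fin b} → KAdj v w → KAdj (Sum.swap v) (Sum.swap w)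
KAdj-swap {v = inj₁ _} {inj₂ _} _ = tt
KAdj-swap {v = inj₂ _} {inj₁ _} _ = tt

module _ {a b : ℕ} where

  KAdj-map : ∀ {a′ b′} (f : Fin a → Fin a′) (g : Fin b → Fin b′) {v w} →
             KAdj v w → KAdj (Sum.map f g v) (Sum.map f g w)
  KAdj-map f g {inj₁ _} {inj₂ _} _ = tt
  KAdj-map f g {inj₂ _} {inj₁ _} _ = tt

  K-relabel : Permutation′ a → Permutation′ b → K a b ≅ K a b
  K-relabel π σ = record
    { to       = Sum.map (π ⟨$⟩ʳ_) (σ ⟨$⟩ʳ_)
    ; from     = Sum.map (π ⟨$⟩ˡ_) (σ ⟨$⟩ˡ_)
    ; from∘to  = λ { (inj₁ x) → cong inj₁ (inverseˡ π) ; (inj₂ y) → cong inj₂ (inverseˡ σ) }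
    ; to∘from  = λ { (inj₁ x) → cong inj₁ (inverseʳ π) ; (inj₂ y) → cong inj₂ (inverseʳ σ) }
    ; to-adj   = KAdj-map _ _
    ; from-adj = KAdj-map _ _
    }

  K-swap : K a b ≅ K b a
  K-swap = record
    { to       = Sum.swap
    ; from     = Sum.swap
    ; from∘to  = swap-involutive
    ; to∘from  = swap-involutive
    ; to-adj   = KAdj-swap
    ; from-adj = KAdj-swap
    }

avoidingPairs-everywhere : ∀ {a b} → AvoidingPairAt (K (suc a) (suc b)) (inj₁ zero) →
                           AvoidingPairAt (K (suc b) (suc a)) (inj₁ zero) →
                           ∀ u → AvoidingPairAt (K (suc a) (suc b)) u
avoidingPairs-everywhere atA atB (inj₁ x) = mapAvoidingPair (K-relabel (transpose zero x) Perm.id) atA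
avoidingPairs-everywhere atA atB (inj₂ y) =
  mapAvoidingPair K-swap (mapAvoidingPair (K-relabel (transpose zero y) Perm.id) atB)

module Construction (r s : ℕ) where

  -- A and T reduce to successors, so suc (A ∸ 1) = A, suc (T ∸ 1) = T and T ∸ 1 = (A ∸ 1) + suc s * A
  -- hold definitionally; the special times below are used in that form.
  A S T : ℕ
  A = 2 * suc (suc r)
  S = suc (suc s)
  T = S * A

  α : ℕ → Fin A
  α t = t mod A

  parity : ℕ → Fin 2
  parity t = t mod 2

  round : ℕ → Fin S
  round t = (t / A) mod S

  β : ℕ → Fin (2 * S)
  β t = combine (parity t) (round t)

  α′ : ℕ → Fin A
  α′ = α ∘ suc [ 0 ≔ zero ] [ T ∸ 1 ≔ suc zero ] [ T ≔ zero ]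

  ρ : ℕ → Fin S
  ρ = round ∘ suc [ A ∸ 2 ≔ fromℕ (suc s) ] [ T ∸ 2 ≔ zero ]

  β′ : ℕ → Fin (2 * S)
  β′ t = combine (parity (suc t)) (ρ t)

  α-periodic : ∀ i j → α (i + j * A) ≡ α i
  α-periodic = mod-periodic

  parity-periodic : ∀ i j → parity (i + j * A) ≡ parity i
  parity-periodic i j = trans (cong (λ k → (i + k) mod 2) j*A≡) (mod-periodic i (j * suc (suc r)))
    where
    j*A≡ : j * A ≡ j * suc (suc r) * 2
    j*A≡ = solve 2 (λ j r → j :* (con 2 :* r) := j :* r :* con 2) refl j (suc (suc r))

  round-+*A : ∀ i j → i < A → round (i + j * A) ≡ j mod S
  round-+*A i j i<A =
    cong (_mod S) (trans (+-distrib-/ i (j * A) i%A+j*A%A<A) (cong₂ _+_ (m<n⇒m/n≡0 i<A) (m*n/n≡m j A)))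
    where
    i%A+j*A%A<A : i % A + j * A % A < A
    i%A+j*A%A<A = subst (_< A) (sym (trans (cong₂ _+_ (m<n⇒m%n≡m i<A) (m*n%n≡0 j A)) (+-identityʳ i))) i<A

  round-<A : ∀ {i} → i < A → round i ≡ zero
  round-<A {i} i<A = trans (cong round (sym (+-identityʳ i))) (round-+*A i 0 i<A)

  α-suc : ∀ t → α (suc t) ≢ α t
  α-suc = suc-mod≢mod (s≤s (s≤s z≤n))

  parity-suc : ∀ t → parity (suc t) ≢ parity t
  parity-suc = suc-mod≢mod (s≤s (s≤s z≤n))

  i+j*A<T : ∀ {i j} → i < A → j < S → i + j * A < T
  i+j*A<T {i} {j} i<A j<S = ≤-trans (+-monoˡ-< (j * A) i<A) (*-monoˡ-≤ A j<S)

  predecessor : ∀ (x : Fin A) (g : Fin S) →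
                ∃ λ t → t < T × α (suc t) ≡ x × parity (suc t) ≡ parity (toℕ x) × round t ≡ g
  predecessor zero g =
    (A ∸ 1) + toℕ g * A , i+j*A<T (n<1+n _) (toℕ<n g) ,
    α-periodic 0 (suc (toℕ g)) , parity-periodic 0 (suc (toℕ g)) ,
    trans (round-+*A (A ∸ 1) (toℕ g) (n<1+n _)) (toℕ-mod-id g)
  predecessor (suc x) g =
    toℕ x + toℕ g * A , i+j*A<T x<A (toℕ<n g) ,
    trans (α-periodic (suc (toℕ x)) (toℕ g)) (toℕ-mod-id (suc x)) , parity-periodic (suc (toℕ x)) (toℕ g) ,
    trans (round-+*A (toℕ x) (toℕ g) x<A) (toℕ-mod-id g)
    where
    x<A : toℕ x < A
    x<A = <-trans (n<1+n _) (toℕ<n (suc x))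

  C-visitEdge : ∀ x y → ∃ λ u → u < T × VisitEdge α β u (x , y)
  C-visitEdge x y with combine-surjective {2} {S} y
  ... | e , g , refl with e ≟ᶠ parity (toℕ x)
  ... | yes refl =
    toℕ x + toℕ g * A , i+j*A<T (toℕ<n x) (toℕ<n g) ,
    inj₁ (cong₂ _,_ (trans (α-periodic (toℕ x) (toℕ g)) (toℕ-mod-id x))
                    (cong₂ combine (parity-periodic (toℕ x) (toℕ g))
                                   (trans (round-+*A (toℕ x) (toℕ g) (toℕ<n x)) (toℕ-mod-id g))))
  ... | no e≢ with predecessor x g
  ...   | t , t<T , αx , parity≡ , round≡ =
    t , t<T , inj₂ (cong₂ _,_ αx (cong₂ combine parity-t≡e round≡))
    where
    parity-t≡e : parity t ≡ e
    parity-t≡e = sym (Fin2-≢≢⇒≡ (parity-suc t) λ eq → e≢ (trans eq parity≡))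

  C-traversed : ∀ x y → Traversed α β T (x , y)
  C-traversed x y = let (u , u<T , e) = C-visitEdge x y in traversed-visitEdge u u<T e

  0<A∸2 : 0 < A ∸ 2
  0<A∸2 = ≤-trans (s≤s z≤n) (m≤n+m _ r)

  A∸2<T∸2 : A ∸ 2 < T ∸ 2
  A∸2<T∸2 = m<m+n (A ∸ 2) (s≤s z≤n)

  A∸2<T∸1 : A ∸ 2 < T ∸ 1
  A∸2<T∸1 = <-trans A∸2<T∸2 (n<1+n _)

  A∸1<T∸1 : A ∸ 1 < T ∸ 1
  A∸1<T∸1 = s≤s A∸2<T∸2

  0<T∸2 : 0 < T ∸ 2
  0<T∸2 = <-trans 0<A∸2 A∸2<T∸2

  T∸1<T : T ∸ 1 < T
  T∸1<T = n<1+n _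

  A∸1<T : A ∸ 1 < T
  A∸1<T = <-trans A∸1<T∸1 T∸1<T

  T∸2<T : T ∸ 2 < T
  T∸2<T = <-trans (n<1+n _) T∸1<T

  A∸2<T : A ∸ 2 < T
  A∸2<T = <-trans A∸2<T∸1 T∸1<T

  α-A : α A ≡ zero
  α-A = toℕ-injective (trans (toℕ-mod A) (n%n≡0 A))

  α-T : α T ≡ zero
  α-T = α-periodic 0 S

  α-T∸1 : α (T ∸ 1) ≡ α (A ∸ 1)
  α-T∸1 = α-periodic (A ∸ 1) (suc s)

  parity-A∸1 : parity (A ∸ 1) ≡ suc zero
  parity-A∸1 = Fin2-≢≢⇒≡ {zero} (λ ()) λ eq → parity-suc (A ∸ 1) (trans parity-A (sym eq))
    where
    parity-A : parity A ≡ zero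
    parity-A = trans (cong parity (sym (+-identityʳ A))) (parity-periodic 0 1)

  parity-T∸1 : parity (T ∸ 1) ≡ suc zero
  parity-T∸1 = trans (parity-periodic (A ∸ 1) (suc s)) parity-A∸1

  round-T∸1 : round (T ∸ 1) ≡ fromℕ (suc s)
  round-T∸1 = trans (round-+*A (A ∸ 1) (suc s) (n<1+n _)) (toℕ-injective (begin
    toℕ (suc s mod S)   ≡⟨ toℕ-mod (suc s) ⟩
    suc s % S           ≡⟨ m<n⇒m%n≡m (n<1+n _) ⟩
    suc s               ≡⟨ toℕ-fromℕ (suc s) ⟨
    toℕ (fromℕ (suc s)) ∎))
    where open ≡-Reasoning

  β-T : β T ≡ β 0
  β-T = cong₂ combine (parity-periodic 0 S)
                      (trans (round-+*A 0 S (s≤s z≤n)) (toℕ-injective (trans (toℕ-mod S) (n%n≡0 S))))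

  β-A∸1 : β (A ∸ 1) ≡ β 1
  β-A∸1 = cong₂ combine parity-A∸1 (round-<A (n<1+n _))

  α′-shift : ∀ {t} → t ≢ 0 → t ≢ T ∸ 1 → t ≢ T → α′ t ≡ α (suc t)
  α′-shift t≢0 t≢T∸1 t≢T =
    trans ([≔]-unchanged T zero t≢T)
          (trans ([≔]-unchanged (T ∸ 1) (suc zero) t≢T∸1) ([≔]-unchanged 0 zero t≢0))

  α′-0 : α′ 0 ≡ zero
  α′-0 = refl

  α′-T∸1 : α′ (T ∸ 1) ≡ suc zero
  α′-T∸1 = trans ([≔]-unchanged T zero (<⇒≢ T∸1<T)) ([≔]-updated (T ∸ 1) (suc zero))

  α′-T : α′ T ≡ zero
  α′-T = [≔]-updated T zero

  ρ-shift : ∀ {t} → t ≢ A ∸ 2 → t ≢ T ∸ 2 → ρ t ≡ round (suc t)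
  ρ-shift t≢A∸2 t≢T∸2 =
    trans ([≔]-unchanged (T ∸ 2) zero t≢T∸2) ([≔]-unchanged (A ∸ 2) (fromℕ (suc s)) t≢A∸2)

  ρ-A∸2 : ρ (A ∸ 2) ≡ fromℕ (suc s)
  ρ-A∸2 = trans ([≔]-unchanged (T ∸ 2) zero (<⇒≢ A∸2<T∸2)) ([≔]-updated (A ∸ 2) (fromℕ (suc s)))

  ρ-T∸2 : ρ (T ∸ 2) ≡ zero
  ρ-T∸2 = [≔]-updated (T ∸ 2) zero

  β′-shift : ∀ {t} → t ≢ A ∸ 2 → t ≢ T ∸ 2 → β′ t ≡ β (suc t)
  β′-shift {t} t≢A∸2 t≢T∸2 = cong (combine (parity (suc t))) (ρ-shift t≢A∸2 t≢T∸2)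

  β′-T∸1 : β′ (T ∸ 1) ≡ β 0
  β′-T∸1 = trans (β′-shift (>⇒≢ A∸2<T∸1) (>⇒≢ (n<1+n _))) β-T

  β′-A∸2 : β′ (A ∸ 2) ≡ β (T ∸ 1)
  β′-A∸2 = cong₂ combine (trans parity-A∸1 (sym parity-T∸1)) (trans ρ-A∸2 (sym round-T∸1))

  β′-T∸2 : β′ (T ∸ 2) ≡ β (A ∸ 1)
  β′-T∸2 = trans (cong₂ combine parity-T∸1 ρ-T∸2) (sym β-A∸1)

  -- The seven edges of C at times 0, 1, A−1 and T−1 are met by the repaired steps of D;
  -- every other edge of C is used by D one A-step earlier.

  D-even-0 : Traversed α′ β′ T (α 0 , β 0)
  D-even-0 = subst (Traversed α′ β′ T) (cong₂ _,_ α′-T β′-T∸1) (traversed-odd (T ∸ 1) T∸1<T)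

  D-odd-0 : Traversed α′ β′ T (α 1 , β 0)
  D-odd-0 = subst (Traversed α′ β′ T) (cong₂ _,_ α′-T∸1 β′-T∸1) (traversed-even (T ∸ 1) T∸1<T)

  D-even-1 : Traversed α′ β′ T (α 1 , β 1)
  D-even-1 = subst (Traversed α′ β′ T) (cong₂ _,_ α′-T∸1 (trans β′-T∸2 β-A∸1))
                   (traversed-odd (T ∸ 2) T∸2<T)

  D-even-A∸1 : Traversed α′ β′ T (α (A ∸ 1) , β (A ∸ 1))
  D-even-A∸1 = subst (Traversed α′ β′ T)
    (cong₂ _,_ (trans (α′-shift (>⇒≢ 0<T∸2) (<⇒≢ (n<1+n _)) (<⇒≢ T∸2<T)) α-T∸1) β′-T∸2)
    (traversed-even (T ∸ 2) T∸2<T)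

  D-odd-A∸1 : Traversed α′ β′ T (α A , β (A ∸ 1))
  D-odd-A∸1 = subst (Traversed α′ β′ T)
    (cong₂ _,_ (sym α-A) (trans (β′-shift (<⇒≢ 0<A∸2) (<⇒≢ 0<T∸2)) (sym β-A∸1)))
    (traversed-even 0 (s≤s z≤n))

  D-even-T∸1 : Traversed α′ β′ T (α (T ∸ 1) , β (T ∸ 1))
  D-even-T∸1 = subst (Traversed α′ β′ T)
    (cong₂ _,_ (trans (α′-shift (>⇒≢ 0<A∸2) (<⇒≢ A∸2<T∸1) (<⇒≢ A∸2<T)) (sym α-T∸1))
               β′-A∸2)
    (traversed-even (A ∸ 2) A∸2<T)

  D-odd-T∸1 : Traversed α′ β′ T (α T , β (T ∸ 1))
  D-odd-T∸1 = subst (Traversed α′ β′ T)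
    (cong₂ _,_ (trans (α′-shift (λ ()) (<⇒≢ A∸1<T∸1) (<⇒≢ A∸1<T)) (trans α-A (sym α-T)))
               β′-A∸2)
    (traversed-odd (A ∸ 2) A∸2<T)

  D-even : ∀ u → u < T → Traversed α′ β′ T (α u , β u)
  D-even zero          _ = D-even-0
  D-even (suc zero)    _ = D-even-1
  D-even (suc (suc w)) u<T with suc (suc w) ≟ A ∸ 1 | suc (suc w) ≟ T ∸ 1
  ... | yes u≡A∸1 | _ = subst (λ u → Traversed α′ β′ T (α u , β u)) (sym u≡A∸1) D-even-A∸1
  ... | no _ | yes u≡T∸1 = subst (λ u → Traversed α′ β′ T (α u , β u)) (sym u≡T∸1) D-even-T∸1
  ... | no u≢A∸1 | no u≢T∸1 = subst (Traversed α′ β′ T)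
    (cong₂ _,_ (α′-shift (λ ()) (<⇒≢ (≤-pred u<T)) (<⇒≢ (<-trans (n<1+n _) u<T)))
               (β′-shift (u≢A∸1 ∘ cong suc) (u≢T∸1 ∘ cong suc)))
    (traversed-even (suc w) (<-trans (n<1+n _) u<T))

  D-odd : ∀ u → u < T → Traversed α′ β′ T (α (suc u) , β u)
  D-odd zero _ = D-odd-0
  D-odd (suc w) u<T with suc w ≟ A ∸ 1 | suc w ≟ T ∸ 1
  ... | yes u≡A∸1 | _ = subst (λ u → Traversed α′ β′ T (α (suc u) , β u)) (sym u≡A∸1) D-odd-A∸1
  ... | no _ | yes u≡T∸1 = subst (λ u → Traversed α′ β′ T (α (suc u) , β u)) (sym u≡T∸1) D-odd-T∸1
  ... | no u≢A∸1 | no u≢T∸1 = subst (Traversed α′ β′ T)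
    (cong₂ _,_ (α′-shift (λ ()) u≢T∸1 (<⇒≢ u<T))
               (β′-shift (u≢A∸1 ∘ cong suc) (u≢T∸1 ∘ cong suc)))
    (traversed-odd w (<-trans (n<1+n _) u<T))

  D-traversed : ∀ x y → Traversed α′ β′ T (x , y)
  D-traversed x y with C-visitEdge x y
  ... | u , u<T , inj₁ refl = D-even u u<T
  ... | u , u<T , inj₂ refl = D-odd u u<T

  α-apart : ∀ t → 0 < t → t < T → α t ≢ α′ t
  α-apart t 0<t t<T with t ≟ T ∸ 1
  ... | no t≢T∸1 = λ eq → α-suc t (sym (trans eq (α′-shift (>⇒≢ 0<t) t≢T∸1 (<⇒≢ t<T))))
  ... | yes refl = λ eq → <⇒≢ 0<A∸2 (sym (cong pred (begin
    A ∸ 1               ≡⟨ m<n⇒m%n≡m (n<1+n _) ⟨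
    (A ∸ 1) % A         ≡⟨ toℕ-mod (A ∸ 1) ⟨
    toℕ (α (A ∸ 1))     ≡⟨ cong toℕ (trans (sym α-T∸1) (trans eq α′-T∸1)) ⟩
    1                   ∎)))
    where open ≡-Reasoning

  β-apart : ∀ t → β t ≢ β′ t
  β-apart t eq = parity-suc t (sym (combine-injectiveˡ (parity t) (round t) (parity (suc t)) (ρ t) eq))

  T+T≡A*2S : T + T ≡ A * (2 * S)
  T+T≡A*2S = solve 2 (λ A S → S :* A :+ S :* A := A :* (con 2 :* S)) refl A S

  C D : EulerianCircuit (K A (2 * S)) (inj₁ zero) (T + T)
  C = AlternatingCircuit.eulerianCircuit α β T refl α-T T+T≡A*2S C-traversed
  D = AlternatingCircuit.eulerianCircuit α′ β′ T α′-0 α′-T T+T≡A*2S D-traversed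

  avoidingPair : AvoidingPairAt (K A (2 * S)) (inj₁ zero)
  avoidingPair = T + T , C , D , λ i → alternating-apart T α-apart β-apart (toℕ i)

theorem5 : ∀ (r s : ℕ) → 2 ≤ r → 2 ≤ s → DoublyEulerian (K (2 * r) (2 * s))
theorem5 (suc (suc r)) (suc (suc s)) _ _ =
  (inj₁ zero , _ , C) , avoidingPairs-everywhere avoidingPair (Construction.avoidingPair s r)
  where open Construction r s using (C; avoidingPair)
theorem5 (suc zero) (suc (suc s)) (s≤s ()) _
theorem5 (suc r) (suc zero) _ (s≤s ())
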